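{- Let $\mathtt{X}\in\{\mathtt{CT},\mathtt{T}\}$, with $\mathcal{E}_{\mathtt{CT}}=\mathcal{E}_1\cup\{\mathrm{CT},\mathrm{CTP},\mathrm{EL1}\}$ and $\mathcal{E}_{\mathtt{T}}=\mathcal{E}_1\cup\{\mathrm{T},\mathrm{TP},\mathrm{EL1}\}$. Then $\mathcal{E}_{\mathtt{X}}$ is a ground-complete axiomatisation of $\mathrm{BCCSP}_{\|}$ modulo $\sim_{\mathtt{X}}$: for all closed $\mathrm{BCCSP}_{\|}$ terms $p,q$, $p\sim_{\mathtt{X}} q$ if and only if $\mathcal{E}_{\mathtt{X}}\vdash p\approx q$.
   Context: Let $\mathcal{A}$ be a finite non-empty set of actions and $\mathcal{V}$ a countably infinite set of variables. $\mathrm{BCCSP}_{\|}$ terms: $t ::= \mathbf{0} \mid x \mid a.t \mid t+t \mid t \,\|\, t$ ($a\in\mathcal{A}$, $x\in\mathcal{V}$; $ax$ means $a.x$). Closed terms are processes. Transitions: $a.p \xrightarrow{a} p$; if $p \xrightarrow{a} p'$ then $p+q \xrightarrow{a} p'$, $q+p \xrightarrow{a} p'$, $p\|q \xrightarrow{a} p'\|q$, $q \| p \xrightarrow{a} q \| p'$. For $\alpha=a_1\cdots a_n\in\mathcal{A}^*$, $p\xrightarrow{\alpha}p'$ means $p=p_0\xrightarrow{a_1}\cdots\xrightarrow{a_n}p_n=p'$. $\mathtt{T}(p)=\{\alpha\mid \exists p'.\,p\xrightarrow{\alpha}p'\}$ (traces) and $\mathtt{CT}(p)=\{\alpha\mid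 p\xrightarrow{\alpha}p',\ p' \text{ has no outgoing transition}\}$ (completed traces). $p\sim_{\mathtt{T}}q$ iff $\mathtt{T}(p)=\mathtt{T}(q)$; $p\sim_{\mathtt{CT}}q$ iff $\mathtt{T}(p)=\mathtt{T}(q)$ and $\mathtt{CT}(p)=\mathtt{CT}(q)$. $\mathcal{E}\vdash t\approx u$: derivable in equational logic (reflexivity, symmetry, transitivity, substitution instances of axioms, closure under $a.\_$, $+$, $\|$). Axioms with concrete action names stand for all instances with actions from $\mathcal{A}$. $\mathcal{E}_1$: A0 $x+\mathbf{0}\approx x$; A1 $x+y\approx y+x$; A2 $(x+y)+z \approx x+(y+z)$; A3 $x+x\approx x$; P0 $x\|\mathbf{0}\approx x$; P1 $x\|y \approx y \| x$. CT: $a(bx+z)+a(cy+w)\approx a(bx+cy+z+w)$. CTP: $(ax+by+w)\|z\approx(ax+w)\|z+(by+w)\|z$. T: $ax+ay\approx a(x+y)$. TP: $(x+y)\|z\approx x\|z+y\|z$. EL1: $ax\|by\approx a(x\|by)+b(ax\|y)$. -}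

module Defs where

open import Data.Nat using (ℕ; suc)
open import Data.Fin using (Fin)
open import Data.List using (List; []; _∷_)
open import Data.Product using (_×_; ∃-syntax)
open import Data.Empty using (⊥)
open import Relation.Nullary using (¬_)
open import Function.Bundles using (_⇔_)

-- The action set 𝒜 is a finite non-empty set: we take 𝒜 = Fin (suc k) for an arbitrary k.
-- The variable set 𝒱 is ℕ (countably infinite).
Var : Set
Var = ℕ

module BCCSP (k : ℕ) where

  Act : Set
  Act = Fin (suc k)

  infixr 8 _·_
  infixl 6 _⊕_
  infixl 7 _∥_

  data Term : Set where
    𝟎   : Term
    var : Var → Term
    _·_ : Act → Term → Term
    _⊕_ : Term → Term → Term
    _∥_ : Term → Term → Term

  data Closed : Term → Set where
    𝟎   : Closed 𝟎
    _·_ : ∀ a {t} → Closed t → Closed (a · t)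
    _⊕_ : ∀ {t u} → Closed t → Closed u → Closed (t ⊕ u)
    _∥_ : ∀ {t u} → Closed t → Closed u → Closed (t ∥ u)

  Subst : Set
  Subst = Var → Term

  _[_] : Term → Subst → Term
  𝟎 [ σ ] = 𝟎
  var x [ σ ] = σ x
  (a · t) [ σ ] = a · (t [ σ ])
  (t ⊕ u) [ σ ] = (t [ σ ]) ⊕ (u [ σ ])
  (t ∥ u) [ σ ] = (t [ σ ]) ∥ (u [ σ ])

  data _─[_]→_ : Term → Act → Term → Set where
    pre  : ∀ {a p} → (a · p) ─[ a ]→ p
    sumˡ : ∀ {p q a p'} → p ─[ a ]→ p' → (p ⊕ q) ─[ a ]→ p'
    sumʳ : ∀ {p q a p'} → p ─[ a ]→ p' → (q ⊕ p) ─[ a ]→ p'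
    parˡ : ∀ {p q a p'} → p ─[ a ]→ p' → (p ∥ q) ─[ a ]→ (p' ∥ q)
    parʳ : ∀ {p q a p'} → p ─[ a ]→ p' → (q ∥ p) ─[ a ]→ (q ∥ p')

  data _═[_]⇒_ : Term → List Act → Term → Set where
    done : ∀ {p} → p ═[ [] ]⇒ p
    step : ∀ {p a p' α p''} → p ─[ a ]→ p' → p' ═[ α ]⇒ p'' → p ═[ a ∷ α ]⇒ p''

  Stuck : Term → Set
  Stuck p = ∀ a p' → ¬ (p ─[ a ]→ p')

  IsTrace : Term → List Act → Set
  IsTrace p α = ∃[ p' ] (p ═[ α ]⇒ p')

  IsCTrace : Term → List Act → Set
  IsCTrace p α = ∃[ p' ] (p ═[ α ]⇒ p' × Stuck p')

  _∼T_ : Term → Term → Set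
  p ∼T q = ∀ α → IsTrace p α ⇔ IsTrace q α

  _∼CT_ : Term → Term → Set
  p ∼CT q = (p ∼T q) × (∀ α → IsCTrace p α ⇔ IsCTrace q α)

  data Sem : Set where
    CT T : Sem

  _∼[_]_ : Term → Sem → Term → Set
  p ∼[ CT ] q = p ∼CT q
  p ∼[ T ]  q = p ∼T q

  -- axioms, as pairs of open terms; variables x,y,z,w are 0,1,2,3
  x y z w : Term
  x = var 0
  y = var 1
  z = var 2
  w = var 3

  data Ax : Sem → Term → Term → Set where
    -- ℰ₁
    A0 : ∀ {X} → Ax X (x ⊕ 𝟎) x
    A1 : ∀ {X} → Ax X (x ⊕ y) (y ⊕ x)
    A2 : ∀ {X} → Ax X ((x ⊕ y) ⊕ z) (x ⊕ (y ⊕ z))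
    A3 : ∀ {X} → Ax X (x ⊕ x) x
    P0 : ∀ {X} → Ax X (x ∥ 𝟎) x
    P1 : ∀ {X} → Ax X (x ∥ y) (y ∥ x)
    EL1 : ∀ {X} (a b : Act) → Ax X ((a · x) ∥ (b · y)) ((a · (x ∥ (b · y))) ⊕ (b · ((a · x) ∥ y)))
    CTax : ∀ (a b c : Act) →
      Ax CT ((a · ((b · x) ⊕ z)) ⊕ (a · ((c · y) ⊕ w))) (a · ((((b · x) ⊕ (c · y)) ⊕ z) ⊕ w))
    CTP : ∀ (a b : Act) →
      Ax CT ((((a · x) ⊕ (b · y)) ⊕ w) ∥ z) ((((a · x) ⊕ w) ∥ z) ⊕ (((b · y) ⊕ w) ∥ z))
    Tax : ∀ (a : Act) → Ax T ((a · x) ⊕ (a · y)) (a · (x ⊕ y))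
    TP  : Ax T ((x ⊕ y) ∥ z) ((x ∥ z) ⊕ (y ∥ z))

  data _⊢_≈_ (X : Sem) : Term → Term → Set where
    refl  : ∀ {t} → X ⊢ t ≈ t
    sym   : ∀ {t u} → X ⊢ t ≈ u → X ⊢ u ≈ t
    trans : ∀ {t u v} → X ⊢ t ≈ u → X ⊢ u ≈ v → X ⊢ t ≈ v
    ax    : ∀ {t u} → Ax X t u → (σ : Subst) → X ⊢ (t [ σ ]) ≈ (u [ σ ])
    pre   : ∀ (a : Act) {t u} → X ⊢ t ≈ u → X ⊢ (a · t) ≈ (a · u)
    sum   : ∀ {t t' u u'} → X ⊢ t ≈ t' → X ⊢ u ≈ u' → X ⊢ (t ⊕ u) ≈ (t' ⊕ u')
    par   : ∀ {t t' u u'} → X ⊢ t ≈ t' → X ⊢ u ≈ u' → X ⊢ (t ∥ u) ≈ (t' ∥ u')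

-- Soundness is checked against compositional descriptions Trace and CTrace of the (completed)
-- traces, which every axiom instance and every congruence rule preserve.
--
-- Completeness: for closed terms, q ⊑ p (inclusion of traces, and of completed traces for CT)
-- implies ℰ_X ⊢ p ≈ p ⊕ q, by induction on depth; two such inclusions give p ≈ q. Using EL1 and
-- CTP (which follows from TP in the trace case) every closed term is provably a sum of prefixes
-- b · l of shallower closed terms. A summand b · q' of q is absorbed by fusing, with axiom T
-- resp. CT, the summands b · l of p into one prefix b · (Σ l): by the inclusion, q' ⊑ Σ l, so
-- Σ l ≈ Σ l ⊕ q' by induction. CT can only fuse summands whose l can still move; a stuck q' is
-- instead matched by a stuck summand b · l of p, both l and q' being provably 𝟎.

module Submission where

open import Defs
open import Data.Nat using (ℕ; suc; _+_; _⊔_; _≤_; _<_; z≤n; s≤s)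
open import Data.Nat.Properties using (≤-trans; ≤-refl; m≤m⊔n; m≤n⊔m; m≤m+n; m≤n+m; +-mono-≤; +-suc; ⊔-lub; <-≤-trans; ≤-pred)
open import Data.Fin using (_≟_)
open import Data.List using (List; []; _∷_; _++_; map; concatMap; filter)
open import Data.List.Properties using (map-++)
open import Data.List.Membership.Propositional using (_∈_)
open import Data.List.Membership.Propositional.Properties using (∈-map⁺; ∈-map⁻; ∈-filter⁺; ∈-filter⁻)
open import Data.List.Relation.Unary.Any using (here; there)
open import Data.List.Relation.Unary.All as All using (All; []; _∷_)
open import Data.List.Relation.Unary.All.Properties using (concat⁺; map⁺; ++⁺)
open import Data.List.Relation.Ternary.Interleaving.Propositional using (Interleaving; []; consˡ; consʳ; swap; left)
open import Data.List.Relation.Binary.Pointwise as Pointwise using ()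
open import Data.Product as × using (∃-syntax; ∃₂; _×_; _,_; proj₁; proj₂)
open import Data.Sum as ⊎ using (_⊎_; inj₁; inj₂)
open import Data.Empty using (⊥; ⊥-elim)
open import Data.Unit using (⊤; tt)
open import Relation.Nullary using (¬_; Dec; yes; no)
open import Relation.Nullary.Decidable using (_×-dec_; ¬?)
open import Relation.Binary.PropositionalEquality as ≡ using (_≡_)
open import Relation.Binary.Bundles using (Setoid)
import Relation.Binary.Reasoning.Setoid as SetoidReasoning
open import Function.Base using (_∘_)
open import Function.Bundles using (_⇔_; mk⇔; module Equivalence)

module _ (k : ℕ) where
  open BCCSP k

  -- Compositional traces

  Trace : Term → List Act → Set
  Trace 𝟎       α       = α ≡ []
  Trace (var _) α       = α ≡ []
  Trace (a · p) []      = ⊤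
  Trace (a · p) (b ∷ α) = a ≡ b × Trace p α
  Trace (p ⊕ q) α       = Trace p α ⊎ Trace q α
  Trace (p ∥ q) α       = ∃₂ λ β γ → Interleaving β γ α × Trace p β × Trace q γ

  CTrace : Term → List Act → Set
  CTrace 𝟎       α       = α ≡ []
  CTrace (var _) α       = α ≡ []
  CTrace (a · p) []      = ⊥
  CTrace (a · p) (b ∷ α) = a ≡ b × CTrace p α
  CTrace (p ⊕ q) []      = CTrace p [] × CTrace q []
  CTrace (p ⊕ q) (b ∷ α) = CTrace p (b ∷ α) ⊎ CTrace q (b ∷ α)
  CTrace (p ∥ q) α       = ∃₂ λ β γ → Interleaving β γ α × CTrace p β × CTrace q γ

  Trace-[] : ∀ p → Trace p []
  Trace-[] 𝟎       = ≡.refl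
  Trace-[] (var _) = ≡.refl
  Trace-[] (a · p) = tt
  Trace-[] (p ⊕ q) = inj₁ (Trace-[] p)
  Trace-[] (p ∥ q) = [] , [] , [] , Trace-[] p , Trace-[] q

  CTrace⇒Trace : ∀ p α → CTrace p α → Trace p α
  CTrace⇒Trace 𝟎       α       c               = c
  CTrace⇒Trace (var _) α       c               = c
  CTrace⇒Trace (a · p) (b ∷ α) (e , c)         = e , CTrace⇒Trace p α c
  CTrace⇒Trace (p ⊕ q) []      _               = inj₁ (Trace-[] p)
  CTrace⇒Trace (p ⊕ q) (b ∷ α) (inj₁ c)        = inj₁ (CTrace⇒Trace p _ c)
  CTrace⇒Trace (p ⊕ q) (b ∷ α) (inj₂ c)        = inj₂ (CTrace⇒Trace q _ c)
  CTrace⇒Trace (p ∥ q) α (β , γ , i , c , d)   = β , γ , i , CTrace⇒Trace p β c , CTrace⇒Trace q γ d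

  Trace-step : ∀ {p a p' α} → p ─[ a ]→ p' → Trace p' α → Trace p (a ∷ α)
  Trace-step pre       t                   = ≡.refl , t
  Trace-step (sumˡ s)  t                   = inj₁ (Trace-step s t)
  Trace-step (sumʳ s)  t                   = inj₂ (Trace-step s t)
  Trace-step (parˡ s)  (β , γ , i , t , u) = _ , γ , consˡ i , Trace-step s t , u
  Trace-step (parʳ s)  (β , γ , i , t , u) = β , _ , consʳ i , t , Trace-step s u

  CTrace-step : ∀ {p a p' α} → p ─[ a ]→ p' → CTrace p' α → CTrace p (a ∷ α)
  CTrace-step pre       t                   = ≡.refl , t
  CTrace-step (sumˡ s)  t                   = inj₁ (CTrace-step s t)
  CTrace-step (sumʳ s)  t                   = inj₂ (CTrace-step s t)
  CTrace-step (parˡ s)  (β , γ , i , t , u) = _ , γ , consˡ i , CTrace-step s t , u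
  CTrace-step (parʳ s)  (β , γ , i , t , u) = β , _ , consʳ i , t , CTrace-step s u

  Trace-unstep : ∀ p {a α} → Trace p (a ∷ α) → ∃[ p' ] (p ─[ a ]→ p' × Trace p' α)
  Trace-unstep (b · p) (≡.refl , t) = p , pre , t
  Trace-unstep (p ⊕ q) (inj₁ t) with p' , s , t' ← Trace-unstep p t = p' , sumˡ s , t'
  Trace-unstep (p ⊕ q) (inj₂ t) with q' , s , t' ← Trace-unstep q t = q' , sumʳ s , t'
  Trace-unstep (p ∥ q) (_ , γ , consˡ i , t , u) with p' , s , t' ← Trace-unstep p t =
    p' ∥ q , parˡ s , (_ , γ , i , t' , u)
  Trace-unstep (p ∥ q) (β , _ , consʳ i , t , u) with q' , s , u' ← Trace-unstep q u =
    p ∥ q' , parʳ s , (β , _ , i , t , u')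

  CTrace-unstep : ∀ p {a α} → CTrace p (a ∷ α) → ∃[ p' ] (p ─[ a ]→ p' × CTrace p' α)
  CTrace-unstep (b · p) (≡.refl , t) = p , pre , t
  CTrace-unstep (p ⊕ q) (inj₁ t) with p' , s , t' ← CTrace-unstep p t = p' , sumˡ s , t'
  CTrace-unstep (p ⊕ q) (inj₂ t) with q' , s , t' ← CTrace-unstep q t = q' , sumʳ s , t'
  CTrace-unstep (p ∥ q) (_ , γ , consˡ i , t , u) with p' , s , t' ← CTrace-unstep p t =
    p' ∥ q , parˡ s , (_ , γ , i , t' , u)
  CTrace-unstep (p ∥ q) (β , _ , consʳ i , t , u) with q' , s , u' ← CTrace-unstep q u =
    p ∥ q' , parʳ s , (β , _ , i , t , u')

  Stuck⇒CTrace-[] : ∀ p → Stuck p → CTrace p []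
  Stuck⇒CTrace-[] 𝟎       _  = ≡.refl
  Stuck⇒CTrace-[] (var _) _  = ≡.refl
  Stuck⇒CTrace-[] (a · p) st = st a p pre
  Stuck⇒CTrace-[] (p ⊕ q) st =
    Stuck⇒CTrace-[] p (λ a p' s → st a p' (sumˡ s)) , Stuck⇒CTrace-[] q (λ a q' s → st a q' (sumʳ s))
  Stuck⇒CTrace-[] (p ∥ q) st = [] , [] , [] ,
    Stuck⇒CTrace-[] p (λ a p' s → st a (p' ∥ q) (parˡ s)) ,
    Stuck⇒CTrace-[] q (λ a q' s → st a (p ∥ q') (parʳ s))

  CTrace-[]⇒Stuck : ∀ p → CTrace p [] → Stuck p
  CTrace-[]⇒Stuck (p ⊕ q) (c , _) a _ (sumˡ s) = CTrace-[]⇒Stuck p c a _ s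
  CTrace-[]⇒Stuck (p ⊕ q) (_ , c) a _ (sumʳ s) = CTrace-[]⇒Stuck q c a _ s
  CTrace-[]⇒Stuck (p ∥ q) (_ , _ , [] , c , _) a _ (parˡ s) = CTrace-[]⇒Stuck p c a _ s
  CTrace-[]⇒Stuck (p ∥ q) (_ , _ , [] , _ , c) a _ (parʳ s) = CTrace-[]⇒Stuck q c a _ s

  IsTrace⇔Trace : ∀ p α → IsTrace p α ⇔ Trace p α
  IsTrace⇔Trace p α = mk⇔ (λ (_ , r) → run⇒Trace r) (Trace⇒run p α)
    where
      run⇒Trace : ∀ {p α p'} → p ═[ α ]⇒ p' → Trace p α
      run⇒Trace {p} done     = Trace-[] p
      run⇒Trace (step s r)   = Trace-step s (run⇒Trace r)
      Trace⇒run : ∀ p α → Trace p α → IsTrace p α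
      Trace⇒run p []      _ = p , done
      Trace⇒run p (a ∷ α) t with Trace-unstep p t
      ... | p' , s , t' with p'' , r ← Trace⇒run p' α t' = p'' , step s r

  IsCTrace⇔CTrace : ∀ p α → IsCTrace p α ⇔ CTrace p α
  IsCTrace⇔CTrace p α = mk⇔ (λ (_ , r , st) → run⇒CTrace r st) (CTrace⇒run p α)
    where
      run⇒CTrace : ∀ {p α p'} → p ═[ α ]⇒ p' → Stuck p' → CTrace p α
      run⇒CTrace {p} done st   = Stuck⇒CTrace-[] p st
      run⇒CTrace (step s r) st = CTrace-step s (run⇒CTrace r st)
      CTrace⇒run : ∀ p α → CTrace p α → IsCTrace p α
      CTrace⇒run p []      c = p , done , CTrace-[]⇒Stuck p c
      CTrace⇒run p (a ∷ α) c with CTrace-unstep p c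
      ... | p' , s , c' with p'' , r , st ← CTrace⇒run p' α c' = p'' , step s r , st

  infix 4 _⊆T_ _⊆CT_ _⊑[_]_ _≃[_]_

  _⊆T_ _⊆CT_ : Term → Term → Set
  p ⊆T q  = ∀ α → Trace p α → Trace q α
  p ⊆CT q = ∀ α → CTrace p α → CTrace q α

  _⊑[_]_ : Term → Sem → Term → Set
  p ⊑[ T ]  q = p ⊆T q
  p ⊑[ CT ] q = p ⊆T q × p ⊆CT q

  _≃[_]_ : Term → Sem → Term → Set
  p ≃[ X ] q = p ⊑[ X ] q × q ⊑[ X ] p

  ⇔-pointwise : {P P' Q Q' : List Act → Set} → (∀ α → P α ⇔ P' α) → (∀ α → Q α ⇔ Q' α) →
                (∀ α → P α ⇔ Q α) ⇔ ((∀ α → P' α → Q' α) × (∀ α → Q' α → P' α))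
  ⇔-pointwise P⇔P' Q⇔Q' = mk⇔
    (λ e → (λ α → to (Q⇔Q' α) ∘ to (e α) ∘ from (P⇔P' α)) ,
           (λ α → to (P⇔P' α) ∘ from (e α) ∘ from (Q⇔Q' α)))
    (λ (s , s') α → mk⇔ (from (Q⇔Q' α) ∘ s α ∘ to (P⇔P' α)) (from (P⇔P' α) ∘ s' α ∘ to (Q⇔Q' α)))
    where open Equivalence

  ∼T⇔⊆T : ∀ {p q} → p ∼T q ⇔ (p ⊆T q × q ⊆T p)
  ∼T⇔⊆T {p} {q} = ⇔-pointwise (IsTrace⇔Trace p) (IsTrace⇔Trace q)

  IsCTrace-equiv⇔⊆CT : ∀ {p q} → (∀ α → IsCTrace p α ⇔ IsCTrace q α) ⇔ (p ⊆CT q × q ⊆CT p)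
  IsCTrace-equiv⇔⊆CT {p} {q} = ⇔-pointwise (IsCTrace⇔CTrace p) (IsCTrace⇔CTrace q)

  ∼⇔≃ : ∀ X {p q} → (p ∼[ X ] q) ⇔ (p ≃[ X ] q)
  ∼⇔≃ T  = ∼T⇔⊆T
  ∼⇔≃ CT = mk⇔
    (λ (e , c) → let (t , t') = to ∼T⇔⊆T e ; (d , d') = to IsCTrace-equiv⇔⊆CT c in (t , d) , (t' , d'))
    (λ ((t , d) , (t' , d')) → from ∼T⇔⊆T (t , t') , from IsCTrace-equiv⇔⊆CT (d , d'))
    where open Equivalence

  mk⊑ : ∀ X {p q} → p ⊆T q → p ⊆CT q → p ⊑[ X ] q
  mk⊑ T  t _ = t
  mk⊑ CT t c = t , c

  mk≃ : ∀ X {p q} → p ⊆T q → q ⊆T p → p ⊆CT q → q ⊆CT p → p ≃[ X ] q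
  mk≃ X t t' c c' = mk⊑ X t c , mk⊑ X t' c'

  ⊑-refl : ∀ X {p} → p ⊑[ X ] p
  ⊑-refl X = mk⊑ X (λ _ t → t) (λ _ c → c)

  ⊑-trans : ∀ X {p q r} → p ⊑[ X ] q → q ⊑[ X ] r → p ⊑[ X ] r
  ⊑-trans T  s s' α = s' α ∘ s α
  ⊑-trans CT (s , c) (s' , c') = (λ α → s' α ∘ s α) , (λ α → c' α ∘ c α)

  ·-mono-⊆T : ∀ {a p q} → p ⊆T q → a · p ⊆T a · q
  ·-mono-⊆T s []      _       = tt
  ·-mono-⊆T s (b ∷ α) (e , t) = e , s α t

  ·-mono-⊆CT : ∀ {a p q} → p ⊆CT q → a · p ⊆CT a · q
  ·-mono-⊆CT s (b ∷ α) (e , c) = e , s α c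

  ⊕-mono-⊆T : ∀ {p p' q q'} → p ⊆T p' → q ⊆T q' → p ⊕ q ⊆T p' ⊕ q'
  ⊕-mono-⊆T s s' α = ⊎.map (s α) (s' α)

  ⊕-mono-⊆CT : ∀ {p p' q q'} → p ⊆CT p' → q ⊆CT q' → p ⊕ q ⊆CT p' ⊕ q'
  ⊕-mono-⊆CT s s' []      = ×.map (s []) (s' [])
  ⊕-mono-⊆CT s s' (b ∷ α) = ⊎.map (s _) (s' _)

  ∥-mono-⊆T : ∀ {p p' q q'} → p ⊆T p' → q ⊆T q' → p ∥ q ⊆T p' ∥ q'
  ∥-mono-⊆T s s' α (β , γ , i , t , u) = β , γ , i , s β t , s' γ u

  ∥-mono-⊆CT : ∀ {p p' q q'} → p ⊆CT p' → q ⊆CT q' → p ∥ q ⊆CT p' ∥ q'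
  ∥-mono-⊆CT s s' α (β , γ , i , c , d) = β , γ , i , s β c , s' γ d

  ·-mono-⊑ : ∀ X a {p q} → p ⊑[ X ] q → a · p ⊑[ X ] a · q
  ·-mono-⊑ T  a s       = ·-mono-⊆T s
  ·-mono-⊑ CT a (s , c) = ·-mono-⊆T s , ·-mono-⊆CT c

  ⊕-mono-⊑ : ∀ X {p p' q q'} → p ⊑[ X ] p' → q ⊑[ X ] q' → p ⊕ q ⊑[ X ] p' ⊕ q'
  ⊕-mono-⊑ T  s s'               = ⊕-mono-⊆T s s'
  ⊕-mono-⊑ CT (s , c) (s' , c') = ⊕-mono-⊆T s s' , ⊕-mono-⊆CT c c'

  ∥-mono-⊑ : ∀ X {p p' q q'} → p ⊑[ X ] p' → q ⊑[ X ] q' → p ∥ q ⊑[ X ] p' ∥ q'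
  ∥-mono-⊑ T  s s'               = ∥-mono-⊆T s s'
  ∥-mono-⊑ CT (s , c) (s' , c') = ∥-mono-⊆T s s' , ∥-mono-⊆CT c c'

  -- Soundness

  interleaving-[]ʳ : ∀ {β α : List Act} → Interleaving β [] α → β ≡ α
  interleaving-[]ʳ []        = ≡.refl
  interleaving-[]ʳ (consˡ i) = ≡.cong (_ ∷_) (interleaving-[]ʳ i)

  A0-sound : ∀ X p → p ⊕ 𝟎 ≃[ X ] p
  A0-sound X p = mk≃ X tr⇒ (λ _ → inj₁) ct⇒ ct⇐
    where
      tr⇒ : p ⊕ 𝟎 ⊆T p
      tr⇒ α   (inj₁ t)        = t
      tr⇒ .[] (inj₂ ≡.refl)   = Trace-[] p
      ct⇒ : p ⊕ 𝟎 ⊆CT p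
      ct⇒ []      (c , _)  = c
      ct⇒ (b ∷ α) (inj₁ c) = c
      ct⇐ : p ⊆CT p ⊕ 𝟎
      ct⇐ []      c = c , ≡.refl
      ct⇐ (b ∷ α) c = inj₁ c

  A1-sound : ∀ X p q → p ⊕ q ≃[ X ] q ⊕ p
  A1-sound X p q = mk≃ X (λ _ → ⊎.swap) (λ _ → ⊎.swap) (ct p q) (ct q p)
    where
      ct : ∀ p q → p ⊕ q ⊆CT q ⊕ p
      ct p q []      = ×.swap
      ct p q (b ∷ α) = ⊎.swap

  A2-sound : ∀ X p q r → (p ⊕ q) ⊕ r ≃[ X ] p ⊕ (q ⊕ r)
  A2-sound X p q r = mk≃ X (λ _ → ⊎.assocʳ) (λ _ → ⊎.assocˡ) ct⇒ ct⇐
    where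
      ct⇒ : (p ⊕ q) ⊕ r ⊆CT p ⊕ (q ⊕ r)
      ct⇒ []      = ×.assocʳ′
      ct⇒ (b ∷ α) = ⊎.assocʳ
      ct⇐ : p ⊕ (q ⊕ r) ⊆CT (p ⊕ q) ⊕ r
      ct⇐ []      = ×.assocˡ′
      ct⇐ (b ∷ α) = ⊎.assocˡ

  A3-sound : ∀ X p → p ⊕ p ≃[ X ] p
  A3-sound X p = mk≃ X (λ _ → ⊎.reduce) (λ _ → inj₁) ct⇒ ct⇐
    where
      ct⇒ : p ⊕ p ⊆CT p
      ct⇒ []      = proj₁
      ct⇒ (b ∷ α) = ⊎.reduce
      ct⇐ : p ⊆CT p ⊕ p
      ct⇐ []      c = c , c
      ct⇐ (b ∷ α) c = inj₁ c

  P0-sound : ∀ X p → p ∥ 𝟎 ≃[ X ] p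
  P0-sound X p = mk≃ X (⇒ Trace) (⇐ Trace) (⇒ CTrace) (⇐ CTrace)
    where
      ⇒ : ∀ (S : Term → List Act → Set) α →
          (∃₂ λ β γ → Interleaving β γ α × S p β × γ ≡ []) → S p α
      ⇒ S α (β , .[] , i , s , ≡.refl) = ≡.subst (S p) (interleaving-[]ʳ i) s
      ⇐ : ∀ (S : Term → List Act → Set) α →
          S p α → ∃₂ λ β γ → Interleaving β γ α × S p β × γ ≡ []
      ⇐ S α s = α , [] , left (Pointwise.refl ≡.refl) , s , ≡.refl

  P1-sound : ∀ X p q → p ∥ q ≃[ X ] q ∥ p
  P1-sound X p q = mk≃ X swap∥ swap∥ swap∥ swap∥
    where
      swap∥ : ∀ {A B : List Act → Set} α → (∃₂ λ β γ → Interleaving β γ α × A β × B γ) →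
              ∃₂ λ β γ → Interleaving β γ α × B β × A γ
      swap∥ α (β , γ , i , s , s') = γ , β , swap i , s' , s

  EL1-sound : ∀ X a b p q → a · p ∥ b · q ≃[ X ] a · (p ∥ b · q) ⊕ b · (a · p ∥ q)
  EL1-sound X a b p q = mk≃ X tr⇒ tr⇐ ct⇒ ct⇐
    where
      tr⇒ : a · p ∥ b · q ⊆T a · (p ∥ b · q) ⊕ b · (a · p ∥ q)
      tr⇒ []      _                                 = inj₁ tt
      tr⇒ (c ∷ α) (_ , γ , consˡ i , (e , t) , u)   = inj₁ (e , _ , γ , i , t , u)
      tr⇒ (c ∷ α) (β , _ , consʳ i , t , (e , u))   = inj₂ (e , β , _ , i , t , u)
      tr⇐ : a · (p ∥ b · q) ⊕ b · (a · p ∥ q) ⊆T a · p ∥ b · q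
      tr⇐ []      _                                 = Trace-[] (a · p ∥ b · q)
      tr⇐ (c ∷ α) (inj₁ (e , β , γ , i , t , u))    = _ , γ , consˡ i , (e , t) , u
      tr⇐ (c ∷ α) (inj₂ (e , β , γ , i , t , u))    = β , _ , consʳ i , t , (e , u)
      ct⇒ : a · p ∥ b · q ⊆CT a · (p ∥ b · q) ⊕ b · (a · p ∥ q)
      ct⇒ []      (_ , _ , [] , () , _)
      ct⇒ (c ∷ α) (_ , γ , consˡ i , (e , t) , u)   = inj₁ (e , _ , γ , i , t , u)
      ct⇒ (c ∷ α) (β , _ , consʳ i , t , (e , u))   = inj₂ (e , β , _ , i , t , u)
      ct⇐ : a · (p ∥ b · q) ⊕ b · (a · p ∥ q) ⊆CT a · p ∥ b · q
      ct⇐ (c ∷ α) (inj₁ (e , β , γ , i , t , u))    = _ , γ , consˡ i , (e , t) , u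
      ct⇐ (c ∷ α) (inj₂ (e , β , γ , i , t , u))    = β , _ , consʳ i , t , (e , u)

  T-sound : ∀ a p q → a · p ⊕ a · q ≃[ T ] a · (p ⊕ q)
  T-sound a p q = tr⇒ , tr⇐
    where
      tr⇒ : a · p ⊕ a · q ⊆T a · (p ⊕ q)
      tr⇒ []      _              = tt
      tr⇒ (b ∷ α) (inj₁ (e , t)) = e , inj₁ t
      tr⇒ (b ∷ α) (inj₂ (e , t)) = e , inj₂ t
      tr⇐ : a · (p ⊕ q) ⊆T a · p ⊕ a · q
      tr⇐ []      _              = inj₁ tt
      tr⇐ (b ∷ α) (e , inj₁ t)   = inj₁ (e , t)
      tr⇐ (b ∷ α) (e , inj₂ t)   = inj₂ (e , t)

  TP-sound : ∀ p q r → (p ⊕ q) ∥ r ≃[ T ] p ∥ r ⊕ q ∥ r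
  TP-sound p q r = tr⇒ , tr⇐
    where
      tr⇒ : (p ⊕ q) ∥ r ⊆T p ∥ r ⊕ q ∥ r
      tr⇒ α (β , γ , i , inj₁ t , u) = inj₁ (β , γ , i , t , u)
      tr⇒ α (β , γ , i , inj₂ t , u) = inj₂ (β , γ , i , t , u)
      tr⇐ : p ∥ r ⊕ q ∥ r ⊆T (p ⊕ q) ∥ r
      tr⇐ α (inj₁ (β , γ , i , t , u)) = β , γ , i , inj₁ t , u
      tr⇐ α (inj₂ (β , γ , i , t , u)) = β , γ , i , inj₂ t , u

  CT-sound : ∀ a b c p q r s →
    a · (b · p ⊕ r) ⊕ a · (c · q ⊕ s) ≃[ CT ] a · (((b · p ⊕ c · q) ⊕ r) ⊕ s)
  CT-sound a b c p q r s = (tr⇒ , ct⇒) , (tr⇐ , ct⇐)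
    where
      tr⇒ : a · (b · p ⊕ r) ⊕ a · (c · q ⊕ s) ⊆T a · (((b · p ⊕ c · q) ⊕ r) ⊕ s)
      tr⇒ []      _                   = tt
      tr⇒ (d ∷ α) (inj₁ (e , inj₁ t)) = e , inj₁ (inj₁ (inj₁ t))
      tr⇒ (d ∷ α) (inj₁ (e , inj₂ t)) = e , inj₁ (inj₂ t)
      tr⇒ (d ∷ α) (inj₂ (e , inj₁ t)) = e , inj₁ (inj₁ (inj₂ t))
      tr⇒ (d ∷ α) (inj₂ (e , inj₂ t)) = e , inj₂ t
      tr⇐ : a · (((b · p ⊕ c · q) ⊕ r) ⊕ s) ⊆T a · (b · p ⊕ r) ⊕ a · (c · q ⊕ s)
      tr⇐ []      _                             = inj₁ tt
      tr⇐ (d ∷ α) (e , inj₁ (inj₁ (inj₁ t)))    = inj₁ (e , inj₁ t)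
      tr⇐ (d ∷ α) (e , inj₁ (inj₁ (inj₂ t)))    = inj₂ (e , inj₁ t)
      tr⇐ (d ∷ α) (e , inj₁ (inj₂ t))           = inj₁ (e , inj₂ t)
      tr⇐ (d ∷ α) (e , inj₂ t)                  = inj₂ (e , inj₂ t)
      ct⇒ : a · (b · p ⊕ r) ⊕ a · (c · q ⊕ s) ⊆CT a · (((b · p ⊕ c · q) ⊕ r) ⊕ s)
      ct⇒ []          (() , _)
      ct⇒ (d ∷ [])    (inj₁ (e , (() , _)))
      ct⇒ (d ∷ [])    (inj₂ (e , (() , _)))
      ct⇒ (d ∷ f ∷ α) (inj₁ (e , inj₁ t)) = e , inj₁ (inj₁ (inj₁ t))
      ct⇒ (d ∷ f ∷ α) (inj₁ (e , inj₂ t)) = e , inj₁ (inj₂ t)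
      ct⇒ (d ∷ f ∷ α) (inj₂ (e , inj₁ t)) = e , inj₁ (inj₁ (inj₂ t))
      ct⇒ (d ∷ f ∷ α) (inj₂ (e , inj₂ t)) = e , inj₂ t
      ct⇐ : a · (((b · p ⊕ c · q) ⊕ r) ⊕ s) ⊆CT a · (b · p ⊕ r) ⊕ a · (c · q ⊕ s)
      ct⇐ (d ∷ [])    (e , (((() , _) , _) , _))
      ct⇐ (d ∷ f ∷ α) (e , inj₁ (inj₁ (inj₁ t))) = inj₁ (e , inj₁ t)
      ct⇐ (d ∷ f ∷ α) (e , inj₁ (inj₁ (inj₂ t))) = inj₂ (e , inj₁ t)
      ct⇐ (d ∷ f ∷ α) (e , inj₁ (inj₂ t))        = inj₁ (e , inj₂ t)
      ct⇐ (d ∷ f ∷ α) (e , inj₂ t)               = inj₂ (e , inj₂ t)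

  CTP-sound : ∀ a b p q r s →
    ((a · p ⊕ b · q) ⊕ s) ∥ r ≃[ CT ] (a · p ⊕ s) ∥ r ⊕ (b · q ⊕ s) ∥ r
  CTP-sound a b p q r s = (tr⇒ , ct⇒) , (tr⇐ , ct⇐)
    where
      tr⇒ : ((a · p ⊕ b · q) ⊕ s) ∥ r ⊆T (a · p ⊕ s) ∥ r ⊕ (b · q ⊕ s) ∥ r
      tr⇒ α (β , γ , i , inj₁ (inj₁ t) , u) = inj₁ (β , γ , i , inj₁ t , u)
      tr⇒ α (β , γ , i , inj₁ (inj₂ t) , u) = inj₂ (β , γ , i , inj₁ t , u)
      tr⇒ α (β , γ , i , inj₂ t , u)        = inj₁ (β , γ , i , inj₂ t , u)
      tr⇐ : (a · p ⊕ s) ∥ r ⊕ (b · q ⊕ s) ∥ r ⊆T ((a · p ⊕ b · q) ⊕ s) ∥ r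
      tr⇐ α (inj₁ (β , γ , i , inj₁ t , u)) = β , γ , i , inj₁ (inj₁ t) , u
      tr⇐ α (inj₁ (β , γ , i , inj₂ t , u)) = β , γ , i , inj₂ t , u
      tr⇐ α (inj₂ (β , γ , i , inj₁ t , u)) = β , γ , i , inj₁ (inj₂ t) , u
      tr⇐ α (inj₂ (β , γ , i , inj₂ t , u)) = β , γ , i , inj₂ t , u
      ct⇒ : ((a · p ⊕ b · q) ⊕ s) ∥ r ⊆CT (a · p ⊕ s) ∥ r ⊕ (b · q ⊕ s) ∥ r
      ct⇒ []      (_ , _ , [] , ((() , _) , _) , _)
      ct⇒ (c ∷ α) ([] , γ , i , ((() , _) , _) , _)
      ct⇒ (c ∷ α) (d ∷ β , γ , i , inj₁ (inj₁ t) , u) = inj₁ (d ∷ β , γ , i , inj₁ t , u)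
      ct⇒ (c ∷ α) (d ∷ β , γ , i , inj₁ (inj₂ t) , u) = inj₂ (d ∷ β , γ , i , inj₁ t , u)
      ct⇒ (c ∷ α) (d ∷ β , γ , i , inj₂ t , u)        = inj₁ (d ∷ β , γ , i , inj₂ t , u)
      ct⇐ : (a · p ⊕ s) ∥ r ⊕ (b · q ⊕ s) ∥ r ⊆CT ((a · p ⊕ b · q) ⊕ s) ∥ r
      ct⇐ []      ((_ , _ , [] , (() , _) , _) , _)
      ct⇐ (c ∷ α) (inj₁ ([] , γ , i , (() , _) , _))
      ct⇐ (c ∷ α) (inj₂ ([] , γ , i , (() , _) , _))
      ct⇐ (c ∷ α) (inj₁ (d ∷ β , γ , i , inj₁ t , u)) = d ∷ β , γ , i , inj₁ (inj₁ t) , u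
      ct⇐ (c ∷ α) (inj₁ (d ∷ β , γ , i , inj₂ t , u)) = d ∷ β , γ , i , inj₂ t , u
      ct⇐ (c ∷ α) (inj₂ (d ∷ β , γ , i , inj₁ t , u)) = d ∷ β , γ , i , inj₁ (inj₂ t) , u
      ct⇐ (c ∷ α) (inj₂ (d ∷ β , γ , i , inj₂ t , u)) = d ∷ β , γ , i , inj₂ t , u

  axiom-sound : ∀ {X t u} → Ax X t u → (σ : Subst) → t [ σ ] ≃[ X ] u [ σ ]
  axiom-sound {X} A0 σ  = A0-sound X _
  axiom-sound {X} A1 σ  = A1-sound X _ _
  axiom-sound {X} A2 σ  = A2-sound X _ _ _
  axiom-sound {X} A3 σ  = A3-sound X _
  axiom-sound {X} P0 σ  = P0-sound X _
  axiom-sound {X} P1 σ  = P1-sound X _ _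
  axiom-sound {X} (EL1 a b) σ = EL1-sound X a b _ _
  axiom-sound (CTax a b c) σ  = CT-sound a b c _ _ _ _
  axiom-sound (CTP a b) σ     = CTP-sound a b _ _ _ _
  axiom-sound (Tax a) σ       = T-sound a _ _
  axiom-sound TP σ            = TP-sound _ _ _

  ⊢-sound : ∀ {X p q} → X ⊢ p ≈ q → p ≃[ X ] q
  ⊢-sound {X} refl      = ⊑-refl X , ⊑-refl X
  ⊢-sound (sym d)       = ×.swap (⊢-sound d)
  ⊢-sound (ax a σ)      = axiom-sound a σ
  ⊢-sound {X} (pre a d) = ×.map (·-mono-⊑ X a) (·-mono-⊑ X a) (⊢-sound d)
  ⊢-sound {X} (trans d e) with s , s' ← ⊢-sound d | r , r' ← ⊢-sound e =
    ⊑-trans X s r , ⊑-trans X r' s'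
  ⊢-sound {X} (sum d e)   with s , s' ← ⊢-sound d | r , r' ← ⊢-sound e =
    ⊕-mono-⊑ X s r , ⊕-mono-⊑ X s' r'
  ⊢-sound {X} (par d e)   with s , s' ← ⊢-sound d | r , r' ← ⊢-sound e =
    ∥-mono-⊑ X s r , ∥-mono-⊑ X s' r'

  infix 4 _⊢_≋_ _⊢_≲_

  -- The relation of Defs again, with a fixity binding looser than _⊕_ and _∥_.
  _⊢_≋_ : Sem → Term → Term → Set
  X ⊢ t ≋ u = X ⊢ t ≈ u

  _⊢_≲_ : Sem → Term → Term → Set
  X ⊢ t ≲ u = X ⊢ u ≋ u ⊕ t

  ⊢-setoid : Sem → Setoid _ _
  ⊢-setoid X = record
    { Carrier = Term ; _≈_ = X ⊢_≋_
    ; isEquivalence = record { refl = refl ; sym = sym ; trans = trans } }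

  assign : Term → Term → Term → Term → Subst
  assign p q r s 0 = p
  assign p q r s 1 = q
  assign p q r s 2 = r
  assign p q r s 3 = s
  assign p q r s _ = 𝟎

  module _ {X : Sem} where
    open SetoidReasoning (⊢-setoid X)

    ⊕-identityʳ : ∀ p → X ⊢ p ⊕ 𝟎 ≋ p
    ⊕-identityʳ p = ax A0 (assign p 𝟎 𝟎 𝟎)

    ⊕-comm : ∀ p q → X ⊢ p ⊕ q ≋ q ⊕ p
    ⊕-comm p q = ax A1 (assign p q 𝟎 𝟎)

    ⊕-assoc : ∀ p q r → X ⊢ (p ⊕ q) ⊕ r ≋ p ⊕ (q ⊕ r)
    ⊕-assoc p q r = ax A2 (assign p q r 𝟎)

    ⊕-idem : ∀ p → X ⊢ p ⊕ p ≋ p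
    ⊕-idem p = ax A3 (assign p 𝟎 𝟎 𝟎)

    ∥-identityʳ : ∀ p → X ⊢ p ∥ 𝟎 ≋ p
    ∥-identityʳ p = ax P0 (assign p 𝟎 𝟎 𝟎)

    ∥-comm : ∀ p q → X ⊢ p ∥ q ≋ q ∥ p
    ∥-comm p q = ax P1 (assign p q 𝟎 𝟎)

    ∥-expand : ∀ a b p q → X ⊢ a · p ∥ b · q ≋ a · (p ∥ b · q) ⊕ b · (a · p ∥ q)
    ∥-expand a b p q = ax (EL1 a b) (assign p q 𝟎 𝟎)

    ⊕-interchange : ∀ p q r s → X ⊢ ((p ⊕ q) ⊕ r) ⊕ s ≋ (p ⊕ r) ⊕ (q ⊕ s)
    ⊕-interchange p q r s = begin
      ((p ⊕ q) ⊕ r) ⊕ s   ≈⟨ sum (⊕-assoc p q r) refl ⟩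
      (p ⊕ (q ⊕ r)) ⊕ s   ≈⟨ sum (sum refl (⊕-comm q r)) refl ⟩
      (p ⊕ (r ⊕ q)) ⊕ s   ≈⟨ sum (⊕-assoc p r q) refl ⟨
      ((p ⊕ r) ⊕ q) ⊕ s   ≈⟨ ⊕-assoc (p ⊕ r) q s ⟩
      (p ⊕ r) ⊕ (q ⊕ s)   ∎

    x≲x⊕y : ∀ p q → X ⊢ p ≲ p ⊕ q
    x≲x⊕y p q = begin
      p ⊕ q         ≈⟨ sum (⊕-idem p) refl ⟨
      (p ⊕ p) ⊕ q   ≈⟨ ⊕-assoc p p q ⟩
      p ⊕ (p ⊕ q)   ≈⟨ ⊕-comm p (p ⊕ q) ⟩
      (p ⊕ q) ⊕ p   ∎

    y≲x⊕y : ∀ p q → X ⊢ q ≲ p ⊕ q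
    y≲x⊕y p q = begin
      p ⊕ q         ≈⟨ sum refl (⊕-idem q) ⟨
      p ⊕ (q ⊕ q)   ≈⟨ ⊕-assoc p q q ⟨
      (p ⊕ q) ⊕ q   ∎

    ≲-trans : ∀ {p q r} → X ⊢ p ≲ q → X ⊢ q ≲ r → X ⊢ p ≲ r
    ≲-trans {p} {q} {r} p≲q q≲r = begin
      r               ≈⟨ q≲r ⟩
      r ⊕ q           ≈⟨ sum refl p≲q ⟩
      r ⊕ (q ⊕ p)     ≈⟨ ⊕-assoc r q p ⟨
      (r ⊕ q) ⊕ p     ≈⟨ sum q≲r refl ⟨
      r ⊕ p           ∎

    ≲-resp-≋ : ∀ {p p' q q'} → X ⊢ p ≋ p' → X ⊢ q ≋ q' → X ⊢ p ≲ q → X ⊢ p' ≲ q'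
    ≲-resp-≋ p≋p' q≋q' p≲q = trans (sym q≋q') (trans p≲q (sum q≋q' p≋p'))

    ≲-antisym : ∀ {p q} → X ⊢ p ≲ q → X ⊢ q ≲ p → X ⊢ p ≋ q
    ≲-antisym {p} {q} p≲q q≲p = trans q≲p (trans (⊕-comm p q) (sym p≲q))

    𝟎-≲ : ∀ p → X ⊢ 𝟎 ≲ p
    𝟎-≲ p = sym (⊕-identityʳ p)

    ⊕-lub : ∀ {p q r} → X ⊢ p ≲ r → X ⊢ q ≲ r → X ⊢ p ⊕ q ≲ r
    ⊕-lub {p} {q} {r} p≲r q≲r = begin
      r               ≈⟨ q≲r ⟩
      r ⊕ q           ≈⟨ sum p≲r refl ⟩
      (r ⊕ p) ⊕ q     ≈⟨ ⊕-assoc r p q ⟩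
      r ⊕ (p ⊕ q)     ∎

    ⊕-dedupʳ : ∀ p q r → X ⊢ (p ⊕ r) ⊕ (q ⊕ r) ≋ p ⊕ (q ⊕ r)
    ⊕-dedupʳ p q r = begin
      (p ⊕ r) ⊕ (q ⊕ r)   ≈⟨ ⊕-assoc p r (q ⊕ r) ⟩
      p ⊕ (r ⊕ (q ⊕ r))   ≈⟨ sum refl (⊕-comm r (q ⊕ r)) ⟩
      p ⊕ ((q ⊕ r) ⊕ r)   ≈⟨ sum refl (y≲x⊕y q r) ⟨
      p ⊕ (q ⊕ r)         ∎

  -- Head normal forms

  ⨁ : List Term → Term
  ⨁ []       = 𝟎
  ⨁ (t ∷ ts) = t ⊕ ⨁ ts

  prefix : Act × Term → Term
  prefix (a , p) = a · p

  ⨁· : List (Act × Term) → Term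
  ⨁· L = ⨁ (map prefix L)

  interleavings : Act × Term → Act × Term → List (Act × Term)
  interleavings (a , p) (b , q) = (a , p ∥ b · q) ∷ (b , a · p ∥ q) ∷ []

  -- CTP is derivable from TP, so it holds in both theories.
  CTP-≋ : ∀ X a b p q r s → X ⊢ ((a · p ⊕ b · q) ⊕ s) ∥ r ≋ (a · p ⊕ s) ∥ r ⊕ (b · q ⊕ s) ∥ r
  CTP-≋ CT a b p q r s = ax (CTP a b) (assign p q r s)
  CTP-≋ T  a b p q r s = begin
    ((a · p ⊕ b · q) ⊕ s) ∥ r                   ≈⟨ TP′ _ _ _ ⟩
    (a · p ⊕ b · q) ∥ r ⊕ s ∥ r                 ≈⟨ sum (TP′ _ _ _) refl ⟩
    (a · p ∥ r ⊕ b · q ∥ r) ⊕ s ∥ r             ≈⟨ ⊕-assoc _ _ _ ⟩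
    a · p ∥ r ⊕ (b · q ∥ r ⊕ s ∥ r)             ≈⟨ ⊕-dedupʳ _ _ _ ⟨
    (a · p ∥ r ⊕ s ∥ r) ⊕ (b · q ∥ r ⊕ s ∥ r)   ≈⟨ sum (TP′ _ _ _) (TP′ _ _ _) ⟨
    (a · p ⊕ s) ∥ r ⊕ (b · q ⊕ s) ∥ r           ∎
    where
      open SetoidReasoning (⊢-setoid T)
      TP′ : ∀ p q r → T ⊢ (p ⊕ q) ∥ r ≋ p ∥ r ⊕ q ∥ r
      TP′ p q r = ax TP (assign p q r 𝟎)

  module _ {X : Sem} where
    open SetoidReasoning (⊢-setoid X)

    ∈⇒≲⨁ : ∀ {t ts} → t ∈ ts → X ⊢ t ≲ ⨁ ts
    ∈⇒≲⨁ {t} {.t ∷ ts} (here ≡.refl) = x≲x⊕y t (⨁ ts)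
    ∈⇒≲⨁ {ts = t ∷ ts} (there m)     = ≲-trans (∈⇒≲⨁ m) (y≲x⊕y t (⨁ ts))

    ⨁-least : ∀ {ts u} → All (λ t → X ⊢ t ≲ u) ts → X ⊢ ⨁ ts ≲ u
    ⨁-least []       = 𝟎-≲ _
    ⨁-least (h ∷ hs) = ⊕-lub h (⨁-least hs)

    ⨁-++ : ∀ ts us → X ⊢ ⨁ (ts ++ us) ≋ ⨁ ts ⊕ ⨁ us
    ⨁-++ []       us = trans (sym (⊕-identityʳ _)) (⊕-comm _ 𝟎)
    ⨁-++ (t ∷ ts) us = trans (sum refl (⨁-++ ts us)) (sym (⊕-assoc t _ _))

    ⨁·-++ : ∀ L M → X ⊢ ⨁· (L ++ M) ≋ ⨁· L ⊕ ⨁· M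
    ⨁·-++ L M rewrite map-++ prefix L M = ⨁-++ (map prefix L) (map prefix M)

    ⨁-map≋⨁·-concatMap : ∀ {A : Set} (f : A → Term) (g : A → List (Act × Term)) →
      (∀ x → X ⊢ f x ≋ ⨁· (g x)) → ∀ xs → X ⊢ ⨁ (map f xs) ≋ ⨁· (concatMap g xs)
    ⨁-map≋⨁·-concatMap f g f≋g []       = refl
    ⨁-map≋⨁·-concatMap f g f≋g (x ∷ xs) =
      trans (sum (f≋g x) (⨁-map≋⨁·-concatMap f g f≋g xs)) (sym (⨁·-++ (g x) (concatMap g xs)))

    ∥-distribʳ-⨁· : ∀ s L r → X ⊢ ⨁· (s ∷ L) ∥ r ≋ ⨁ (map (λ s → prefix s ∥ r) (s ∷ L))
    ∥-distribʳ-⨁· s [] r = trans (par (⊕-identityʳ _) refl) (sym (⊕-identityʳ _))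
    ∥-distribʳ-⨁· (a , p) ((b , q) ∷ L) r = begin
      (a · p ⊕ (b · q ⊕ ⨁· L)) ∥ r                      ≈⟨ par (⊕-assoc _ _ _) refl ⟨
      ((a · p ⊕ b · q) ⊕ ⨁· L) ∥ r                      ≈⟨ CTP-≋ X a b p q r (⨁· L) ⟩
      (a · p ⊕ ⨁· L) ∥ r ⊕ (b · q ⊕ ⨁· L) ∥ r           ≈⟨ sum (∥-distribʳ-⨁· (a , p) L r) (∥-distribʳ-⨁· (b , q) L r) ⟩
      (a · p ∥ r ⊕ rest) ⊕ (b · q ∥ r ⊕ rest)           ≈⟨ ⊕-dedupʳ _ _ _ ⟩
      a · p ∥ r ⊕ (b · q ∥ r ⊕ rest)                    ∎
      where rest = ⨁ (map (λ s → prefix s ∥ r) L)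

    ⨁·-∥-⨁· : ∀ s L m M → X ⊢ ⨁· (s ∷ L) ∥ ⨁· (m ∷ M) ≋
      ⨁· (concatMap (λ s → concatMap (interleavings s) (m ∷ M)) (s ∷ L))
    ⨁·-∥-⨁· s L m M = trans (∥-distribʳ-⨁· s L _) (⨁-map≋⨁·-concatMap _ _ row (s ∷ L))
      where
        prefix-∥-prefix : ∀ s m → X ⊢ prefix m ∥ prefix s ≋ ⨁· (interleavings s m)
        prefix-∥-prefix (a , p) (b , q) =
          trans (∥-comm _ _) (trans (∥-expand a b p q) (sum refl (sym (⊕-identityʳ _))))
        row : ∀ s → X ⊢ prefix s ∥ ⨁· (m ∷ M) ≋ ⨁· (concatMap (interleavings s) (m ∷ M))
        row s = trans (∥-comm _ _)
          (trans (∥-distribʳ-⨁· m M _) (⨁-map≋⨁·-concatMap _ _ (prefix-∥-prefix s) (m ∷ M)))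

  depth : Term → ℕ
  depth 𝟎       = 0
  depth (var _) = 0
  depth (a · p) = suc (depth p)
  depth (p ⊕ q) = depth p ⊔ depth q
  depth (p ∥ q) = depth p + depth q

  record ShallowerThan (p : Term) (s : Act × Term) : Set where
    constructor shallower
    field
      closed  : Closed (proj₂ s)
      depth-< : depth (proj₂ s) < depth p

  HeadNormalForm : Sem → Term → Set
  HeadNormalForm X p = ∃[ L ] (All (ShallowerThan p) L × X ⊢ p ≋ ⨁· L)

  ShallowerThan-mono : ∀ p q → depth p ≤ depth q → ∀ {s} → ShallowerThan p s → ShallowerThan q s
  ShallowerThan-mono _ _ p≤q (shallower c d) = shallower c (<-≤-trans d p≤q)

  interleavings-shallower : ∀ p q {s m} → ShallowerThan p s → ShallowerThan q m →
    All (ShallowerThan (p ∥ q)) (interleavings s m)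
  interleavings-shallower p q {a , l} {b , n} (shallower cl dl) (shallower cn dn) =
    shallower (cl ∥ (b · cn)) (+-mono-≤ dl dn) ∷
    shallower ((a · cl) ∥ cn)
      (≡.subst (_≤ depth p + depth q) (+-suc (suc (depth l)) (depth n)) (+-mono-≤ dl dn)) ∷ []

  module _ {X : Sem} where

    hnf-⊕ : ∀ {p q} → HeadNormalForm X p → HeadNormalForm X q → HeadNormalForm X (p ⊕ q)
    hnf-⊕ {p} {q} (L , hL , p≋L) (M , hM , q≋M) =
      L ++ M ,
      ++⁺ (All.map (ShallowerThan-mono p (p ⊕ q) (m≤m⊔n _ _)) hL)
          (All.map (ShallowerThan-mono q (p ⊕ q) (m≤n⊔m (depth p) _)) hM) ,
      trans (sum p≋L q≋M) (sym (⨁·-++ L M))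

    hnf-∥ : ∀ {p q} → HeadNormalForm X p → HeadNormalForm X q → HeadNormalForm X (p ∥ q)
    hnf-∥ {p} {q} ([] , _ , p≋𝟎) (M , hM , q≋M) =
      M , All.map (ShallowerThan-mono q (p ∥ q) (m≤n+m _ (depth p))) hM ,
      trans (par p≋𝟎 refl) (trans (∥-comm 𝟎 q) (trans (∥-identityʳ q) q≋M))
    hnf-∥ {p} {q} (L@(_ ∷ _) , hL , p≋L) ([] , _ , q≋𝟎) =
      L , All.map (ShallowerThan-mono p (p ∥ q) (m≤m+n _ (depth q))) hL ,
      trans (par refl q≋𝟎) (trans (∥-identityʳ p) p≋L)
    hnf-∥ {p} {q} (s ∷ L , hL , p≋L) (m ∷ M , hM , q≋M) =
      concatMap (λ s → concatMap (interleavings s) (m ∷ M)) (s ∷ L) ,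
      concat⁺ (map⁺ (All.map (λ hs → concat⁺ (map⁺ (All.map (interleavings-shallower p q hs) hM))) hL)) ,
      trans (par p≋L q≋M) (⨁·-∥-⨁· s L m M)

    hnf : ∀ {p} → Closed p → HeadNormalForm X p
    hnf 𝟎 = [] , [] , refl
    hnf (a · cp) = (a , _) ∷ [] , shallower cp ≤-refl ∷ [] , sym (⊕-identityʳ _)
    hnf (cp ⊕ cq) = hnf-⊕ (hnf cp) (hnf cq)
    hnf (cp ∥ cq) = hnf-∥ (hnf cp) (hnf cq)

  -- Completeness

  CTrace-[]? : ∀ p → Dec (CTrace p [])
  CTrace-[]? 𝟎       = yes ≡.refl
  CTrace-[]? (var _) = yes ≡.refl
  CTrace-[]? (a · p) = no λ ()
  CTrace-[]? (p ⊕ q) = CTrace-[]? p ×-dec CTrace-[]? q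
  CTrace-[]? (p ∥ q) with CTrace-[]? p | CTrace-[]? q
  ... | yes c | yes d = yes ([] , [] , [] , c , d)
  ... | no ¬c | _     = no λ { (_ , _ , [] , c , _) → ¬c c }
  ... | yes _ | no ¬d = no λ { (_ , _ , [] , _ , d) → ¬d d }

  CTrace-[]⇒¬Trace-∷ : ∀ p {c α} → CTrace p [] → ¬ Trace p (c ∷ α)
  CTrace-[]⇒¬Trace-∷ p st t with p' , s , _ ← Trace-unstep p t = CTrace-[]⇒Stuck p st _ p' s

  ¬CTrace-[]⇒Trace-∷ : ∀ p → ¬ CTrace p [] → ∃[ c ] Trace p (c ∷ [])
  ¬CTrace-[]⇒Trace-∷ 𝟎       ¬st = ⊥-elim (¬st ≡.refl)
  ¬CTrace-[]⇒Trace-∷ (var _) ¬st = ⊥-elim (¬st ≡.refl)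
  ¬CTrace-[]⇒Trace-∷ (a · p) ¬st = a , ≡.refl , Trace-[] p
  ¬CTrace-[]⇒Trace-∷ (p ⊕ q) ¬st with CTrace-[]? p
  ... | no ¬stp with c , t ← ¬CTrace-[]⇒Trace-∷ p ¬stp = c , inj₁ t
  ... | yes stp with c , t ← ¬CTrace-[]⇒Trace-∷ q (λ stq → ¬st (stp , stq)) = c , inj₂ t
  ¬CTrace-[]⇒Trace-∷ (p ∥ q) ¬st with CTrace-[]? p
  ... | no ¬stp with c , t ← ¬CTrace-[]⇒Trace-∷ p ¬stp =
    c , (c ∷ [] , [] , consˡ [] , t , Trace-[] q)
  ... | yes stp with c , t ← ¬CTrace-[]⇒Trace-∷ q (λ stq → ¬st ([] , [] , [] , stp , stq)) =
    c , ([] , c ∷ [] , consʳ [] , Trace-[] p , t)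

  CTrace-[]⇒≋𝟎 : ∀ {X p} → Closed p → CTrace p [] → X ⊢ p ≋ 𝟎
  CTrace-[]⇒≋𝟎 𝟎         _                        = refl
  CTrace-[]⇒≋𝟎 (cp ⊕ cq) (stp , stq)              =
    trans (sum (CTrace-[]⇒≋𝟎 cp stp) (CTrace-[]⇒≋𝟎 cq stq)) (⊕-identityʳ 𝟎)
  CTrace-[]⇒≋𝟎 (cp ∥ cq) (_ , _ , [] , stp , stq) =
    trans (par (CTrace-[]⇒≋𝟎 cp stp) (CTrace-[]⇒≋𝟎 cq stq)) (∥-identityʳ 𝟎)

  Trace-⨁⁺ : ∀ {t ts α} → t ∈ ts → Trace t α → Trace (⨁ ts) α
  Trace-⨁⁺ (here ≡.refl) t = inj₁ t
  Trace-⨁⁺ (there m)     t = inj₂ (Trace-⨁⁺ m t)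

  CTrace-⨁⁺ : ∀ {t ts c α} → t ∈ ts → CTrace t (c ∷ α) → CTrace (⨁ ts) (c ∷ α)
  CTrace-⨁⁺ (here ≡.refl) t = inj₁ t
  CTrace-⨁⁺ (there m)     t = inj₂ (CTrace-⨁⁺ m t)

  CTrace-⨁-[]⁻ : ∀ {t ts} → t ∈ ts → CTrace (⨁ ts) [] → CTrace t []
  CTrace-⨁-[]⁻ (here ≡.refl) (st , _) = st
  CTrace-⨁-[]⁻ (there m)     (_ , st) = CTrace-⨁-[]⁻ m st

  Trace-⨁-∷⇒nonempty : ∀ ts {c α} → Trace (⨁ ts) (c ∷ α) → ∃[ t ] t ∈ ts
  Trace-⨁-∷⇒nonempty (t ∷ ts) _ = t , here ≡.refl

  Trace-⨁·⁻ : ∀ L {b α} → Trace (⨁· L) (b ∷ α) → ∃[ l ] ((b , l) ∈ L × Trace l α)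
  Trace-⨁·⁻ ((a , l) ∷ L) (inj₁ (≡.refl , t)) = l , here ≡.refl , t
  Trace-⨁·⁻ ((a , l) ∷ L) (inj₂ t) with l' , m , t' ← Trace-⨁·⁻ L t = l' , there m , t'

  CTrace-⨁·⁻ : ∀ L {b α} → CTrace (⨁· L) (b ∷ α) → ∃[ l ] ((b , l) ∈ L × CTrace l α)
  CTrace-⨁·⁻ ((a , l) ∷ L) (inj₁ (≡.refl , t)) = l , here ≡.refl , t
  CTrace-⨁·⁻ ((a , l) ∷ L) (inj₂ t) with l' , m , t' ← CTrace-⨁·⁻ L t = l' , there m , t'

  ⨁-closed : ∀ {ts} → All Closed ts → Closed (⨁ ts)
  ⨁-closed []         = 𝟎
  ⨁-closed (ct ∷ cts) = ct ⊕ ⨁-closed cts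

  depth-⨁ : ∀ {n ts} → All (λ t → depth t ≤ n) ts → depth (⨁ ts) ≤ n
  depth-⨁ []         = z≤n
  depth-⨁ (dt ∷ dts) = ⊔-lub dt (depth-⨁ dts)

  Mergeable : Sem → Term → Set
  Mergeable T  _ = ⊤
  Mergeable CT p = ¬ CTrace p []

  mergeable? : ∀ X p → Dec (Mergeable X p)
  mergeable? T  _ = yes tt
  mergeable? CT p = ¬? (CTrace-[]? p)

  Trace-∷⇒Mergeable : ∀ X {p c α} → Trace p (c ∷ α) → Mergeable X p
  Trace-∷⇒Mergeable T  _     = tt
  Trace-∷⇒Mergeable CT {p} t = λ st → CTrace-[]⇒¬Trace-∷ p st t

  ⨁-mergeable : ∀ X {t ts} → t ∈ ts → Mergeable X t → Mergeable X (⨁ ts)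
  ⨁-mergeable T  _ _  = tt
  ⨁-mergeable CT m ¬st = ¬st ∘ CTrace-⨁-[]⁻ m

  ≋𝟎⇒CTrace-[] : ∀ {p} → CT ⊢ p ≋ 𝟎 → CTrace p []
  ≋𝟎⇒CTrace-[] p≋𝟎 = proj₂ (proj₂ (⊢-sound p≋𝟎)) [] ≡.refl

  -- A mergeable process has a head normal form with a summand, which is the shape axiom CT needs.
  merge : ∀ X b {p q} → Closed p → Closed q → Mergeable X p → Mergeable X q →
    X ⊢ b · p ⊕ b · q ≋ b · (p ⊕ q)
  merge T b {p} {q} _ _ _ _ = ax (Tax b) (assign p q 𝟎 𝟎)
  merge CT b {p} {q} cp cq ¬stp ¬stq with hnf cp | hnf cq
  ... | [] , _ , p≋𝟎 | _ = ⊥-elim (¬stp (≋𝟎⇒CTrace-[] p≋𝟎))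
  ... | _ ∷ _ , _ , _ | [] , _ , q≋𝟎 = ⊥-elim (¬stq (≋𝟎⇒CTrace-[] q≋𝟎))
  ... | (c , p') ∷ U , _ , p≋ | (c' , q') ∷ V , _ , q≋ = begin
    b · p ⊕ b · q                                 ≈⟨ sum (pre b p≋) (pre b q≋) ⟩
    b · (c · p' ⊕ ⨁· U) ⊕ b · (c' · q' ⊕ ⨁· V)   ≈⟨ ax (CTax b c c') (assign p' q' (⨁· U) (⨁· V)) ⟩
    b · (((c · p' ⊕ c' · q') ⊕ ⨁· U) ⊕ ⨁· V)     ≈⟨ pre b (⊕-interchange _ _ _ _) ⟩
    b · ((c · p' ⊕ ⨁· U) ⊕ (c' · q' ⊕ ⨁· V))     ≈⟨ pre b (sum p≋ q≋) ⟨
    b · (p ⊕ q)                                   ∎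
    where open SetoidReasoning (⊢-setoid CT)

  merge-⨁ : ∀ X b {t ts} → t ∈ ts → All Closed ts → All (Mergeable X) ts →
    X ⊢ ⨁ (map (b ·_) ts) ≋ b · ⨁ ts
  merge-⨁ X b {ts = _ ∷ []}    _ _ _ = trans (⊕-identityʳ _) (pre b (sym (⊕-identityʳ _)))
  merge-⨁ X b {ts = _ ∷ _ ∷ _} _ (ct ∷ cts) (mt ∷ mts) =
    trans (sum refl (merge-⨁ X b (here ≡.refl) cts mts))
          (merge X b ct (⨁-closed cts) mt (⨁-mergeable X (here ≡.refl) (All.head mts)))

  continuation? : ∀ X b (s : Act × Term) → Dec (proj₁ s ≡ b × Mergeable X (proj₂ s))
  continuation? X b (a , l) = (a ≟ b) ×-dec mergeable? X l

  continuations : Sem → Act → List (Act × Term) → List Term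
  continuations X b L = map proj₂ (filter (continuation? X b) L)

  ∈-continuations⁺ : ∀ {X b L l} → (b , l) ∈ L → Mergeable X l → l ∈ continuations X b L
  ∈-continuations⁺ {X} {b} m ml = ∈-map⁺ proj₂ (∈-filter⁺ (continuation? X b) m (≡.refl , ml))

  ∈-continuations⁻ : ∀ X b L {l} → l ∈ continuations X b L → (b , l) ∈ L × Mergeable X l
  ∈-continuations⁻ X b L m with ∈-map⁻ proj₂ m
  ... | (a , l) , m' , ≡.refl with ∈-filter⁻ (continuation? X b) m'
  ...   | m'' , ≡.refl , ml = m'' , ml

  continuation-⊆T : ∀ X L M {b q} → ⨁· M ⊆T ⨁· L → (b , q) ∈ M → q ⊆T ⨁ (continuations X b L)
  continuation-⊆T X L M s m []      _ = Trace-[] _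
  continuation-⊆T X L M {b} s m (c ∷ α) t
    with l , ml , tl ← Trace-⨁·⁻ L (s (b ∷ c ∷ α) (Trace-⨁⁺ (∈-map⁺ prefix m) (≡.refl , t))) =
    Trace-⨁⁺ (∈-continuations⁺ ml (Trace-∷⇒Mergeable X tl)) tl

  continuation-⊆CT : ∀ L M {b q} → ¬ CTrace q [] → ⨁· M ⊆CT ⨁· L → (b , q) ∈ M →
    q ⊆CT ⨁ (continuations CT b L)
  continuation-⊆CT L M ¬st s m []      st = ⊥-elim (¬st st)
  continuation-⊆CT L M {b} ¬st s m (c ∷ α) ct
    with l , ml , cl ← CTrace-⨁·⁻ L (s (b ∷ c ∷ α) (CTrace-⨁⁺ (∈-map⁺ prefix m) (≡.refl , ct))) =
    CTrace-⨁⁺ (∈-continuations⁺ ml (Trace-∷⇒Mergeable CT (CTrace⇒Trace l _ cl))) cl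

  continuation-⊑ : ∀ X L M {b q} → Mergeable X q → ⨁· M ⊑[ X ] ⨁· L → (b , q) ∈ M →
    q ⊑[ X ] ⨁ (continuations X b L)
  continuation-⊑ T  L M _   s       m = continuation-⊆T T L M s m
  continuation-⊑ CT L M ¬st (s , c) m = continuation-⊆T CT L M s m , continuation-⊆CT L M ¬st c m

  continuations-nonempty : ∀ X L M {b q} → Mergeable X q → ⨁· M ⊑[ X ] ⨁· L → (b , q) ∈ M →
    ∃[ l ] l ∈ continuations X b L
  continuations-nonempty T L M {b} {q} _ s m
    with l , ml , _ ← Trace-⨁·⁻ L (s (b ∷ []) (Trace-⨁⁺ (∈-map⁺ prefix m) (≡.refl , Trace-[] q))) =
    l , ∈-continuations⁺ ml tt
  continuations-nonempty CT L M {q = q} ¬st (s , _) m with c , t ← ¬CTrace-[]⇒Trace-∷ q ¬st =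
    Trace-⨁-∷⇒nonempty _ (continuation-⊆T CT L M s m (c ∷ []) t)

  Absorbs : Sem → ℕ → Set
  Absorbs X n = ∀ {p q} → Closed p → Closed q → depth p ≤ n → depth q ≤ n → q ⊑[ X ] p → X ⊢ q ≲ p

  absorb-mergeable-summand : ∀ X n → Absorbs X n → ∀ L M {p b q} → All (ShallowerThan p) L →
    depth p ≤ suc n → Closed q → depth q ≤ n → Mergeable X q → ⨁· M ⊑[ X ] ⨁· L → (b , q) ∈ M →
    X ⊢ b · q ≲ ⨁· L
  absorb-mergeable-summand X n ih L M {p} {b} {q} hL dp cq dq mq s m = ≲-trans bq≲bS bS≲L
    where
      S : List Term
      S = continuations X b L
      S⁻ : ∀ {l} → l ∈ S → (b , l) ∈ L × Mergeable X l
      S⁻ = ∈-continuations⁻ X b L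
      summand : ∀ {l} → l ∈ S → ShallowerThan p (b , l)
      summand l∈S = All.lookup hL (proj₁ (S⁻ l∈S))
      closedS : All Closed S
      closedS = All.tabulate λ l∈S → ShallowerThan.closed (summand l∈S)
      nonempty : ∃[ l ] l ∈ S
      nonempty = continuations-nonempty X L M mq s m
      q≲S : X ⊢ q ≲ ⨁ S
      q≲S = ih (⨁-closed closedS) cq
        (depth-⨁ (All.tabulate λ l∈S → ≤-pred (≤-trans (ShallowerThan.depth-< (summand l∈S)) dp)))
        dq (continuation-⊑ X L M mq s m)
      bq≲bS : X ⊢ b · q ≲ b · ⨁ S
      bq≲bS = trans (pre b q≲S)
        (sym (merge X b (⨁-closed closedS) cq (⨁-mergeable X (proj₂ nonempty) (proj₂ (S⁻ (proj₂ nonempty)))) mq))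
      bS≲L : X ⊢ b · ⨁ S ≲ ⨁· L
      bS≲L = ≲-resp-≋ (merge-⨁ X b (proj₂ nonempty) closedS (All.tabulate (proj₂ ∘ S⁻))) refl
        (⨁-least (map⁺ (All.tabulate λ l∈S → ∈⇒≲⨁ (∈-map⁺ prefix (proj₁ (S⁻ l∈S))))))

  -- A stuck q has no head normal form fit for merge; instead b · q ≈ b · 𝟎 already occurs in ⨁· L.
  absorb-stuck-summand : ∀ L M {p b q} → All (ShallowerThan p) L → Closed q → CTrace q [] →
    ⨁· M ⊆CT ⨁· L → (b , q) ∈ M → CT ⊢ b · q ≲ ⨁· L
  absorb-stuck-summand L M {b = b} hL cq st s m
    with l , ml , cl ← CTrace-⨁·⁻ L (s (b ∷ []) (CTrace-⨁⁺ (∈-map⁺ prefix m) (≡.refl , st))) =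
    ≲-resp-≋ (pre b (trans l≋𝟎 (sym (CTrace-[]⇒≋𝟎 cq st)))) refl (∈⇒≲⨁ (∈-map⁺ prefix ml))
    where
      l≋𝟎 : CT ⊢ l ≋ 𝟎
      l≋𝟎 = CTrace-[]⇒≋𝟎 (ShallowerThan.closed (All.lookup hL ml)) cl

  absorbs : ∀ X n → Absorbs X n

  absorb-summand : ∀ X n L M {p b q} → All (ShallowerThan p) L → depth p ≤ n →
    Closed q → depth q < n → ⨁· M ⊑[ X ] ⨁· L → (b , q) ∈ M → X ⊢ b · q ≲ ⨁· L
  absorb-summand T (suc n) L M hL dp cq (s≤s dq) s m =
    absorb-mergeable-summand T n (absorbs T n) L M hL dp cq dq tt s m
  absorb-summand CT (suc n) L M {q = q} hL dp cq (s≤s dq) s m with CTrace-[]? q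
  ... | yes st = absorb-stuck-summand L M hL cq st (proj₂ s) m
  ... | no ¬st = absorb-mergeable-summand CT n (absorbs CT n) L M hL dp cq dq ¬st s m

  absorbs X n cp cq dp dq q⊑p with L , hL , p≋L ← hnf {X} cp | M , hM , q≋M ← hnf {X} cq =
    ≲-resp-≋ (sym q≋M) (sym p≋L) (⨁-least (map⁺ (All.tabulate summand≲L)))
    where
      M⊑L : ⨁· M ⊑[ X ] ⨁· L
      M⊑L = ⊑-trans X (proj₂ (⊢-sound q≋M)) (⊑-trans X q⊑p (proj₁ (⊢-sound p≋L)))
      summand≲L : ∀ {s} → s ∈ M → X ⊢ prefix s ≲ ⨁· L
      summand≲L m with shallower cq' dq' ← All.lookup hM m =
        absorb-summand X n L M hL dp cq' (<-≤-trans dq' dq) M⊑L m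

  ⊑⇒≲ : ∀ X {p q} → Closed p → Closed q → q ⊑[ X ] p → X ⊢ q ≲ p
  ⊑⇒≲ X {p} {q} cp cq = absorbs X (depth p ⊔ depth q) cp cq (m≤m⊔n _ _) (m≤n⊔m _ _)

  ∼⇒⊢ : ∀ X {p q} → Closed p → Closed q → p ∼[ X ] q → X ⊢ p ≈ q
  ∼⇒⊢ X cp cq p∼q with p⊑q , q⊑p ← Equivalence.to (∼⇔≃ X) p∼q =
    ≲-antisym (⊑⇒≲ X cq cp p⊑q) (⊑⇒≲ X cp cq q⊑p)

  ⊢⇒∼ : ∀ X {p q} → X ⊢ p ≈ q → p ∼[ X ] q
  ⊢⇒∼ X = Equivalence.from (∼⇔≃ X) ∘ ⊢-sound

theorem5p15 : (k : ℕ) → let open BCCSP k in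
    (X : Sem) (p q : Term) → Closed p → Closed q →
    (p ∼[ X ] q) ⇔ (X ⊢ p ≈ q)
theorem5p15 k X p q cp cq = mk⇔ (∼⇒⊢ k X cp cq) (⊢⇒∼ k X)
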